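{- Let $\mathbb F$ be a finite field. There is an FO+MOD-transduction $\mathsf T_{\mathrm{pm}}$ such that for every matrix class $\mathcal M$ over $\mathbb F$, $\mathsf T_{\mathrm{pm}}(\mathcal M)$ equals the parity-minor closure of $\mathcal M$, i.e. the set of all matrices that are parity minors of some matrix of $\mathcal M$.
   Context: A matrix over $\mathbb F$ with row set $R$ and column set $C$ is identified with the ordered binary structure on $R\uplus C$ with a unary relation marking rows, a total order extending the row and column orders with rows before columns, and for each nonzero $a\in\mathbb F$ a binary relation $E_a(r,c)$ holding iff $r\in R$, $c\in C$ and $M[r,c]=a$. A matrix class is a set of matrices closed under taking submatrices. A deletion removes a row or a column; a sum replaces two consecutive rows (resp. columns) by their entrywise sum in $\mathbb F$ (placed at the position of the first, the second removed). $N$ is a parity minor of $M$ if it can be obtained from $M$ by a finite sequence of deletions and sums. FO+MOD is first-order logic with extra quantifiers $\exists^{i[p]}x\,\psi(x)$ meaning the number of witnesses is $\equiv i\pmod p$. An interpretation from $\Sigma$ to $\Gamma$ consists of a domain formula $\nu(x)$ and formulas $\rho_R$ for each $R\in\Gamma$, producing the structure with domain $\{v:\mathbf A\models\nu(v)\}$ and relations defined by the $\rho_R$ restricted to that domain. A transduction consists of finitely many new unary relation symbols and an interpretation from the extended signature; $\mathsf T(\mathbf A)$ is the set of $\mathsf I(\mathbf A^+)$ over all expansions $\mathbf A^+$ of $\mathbf A$ by the new unary symbols, and $\mathsf T(\mathcal C)=\bigcup_{\mathbf A\in\mathcal C}\mathsf T(\mathbf A)$; it is an FO+MOD-transduction if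 all its formulas are FO+MOD. -}

module Defs where

open import Level using (0ℓ)
open import Algebra.Bundles using (CommutativeRing)
open import Data.Nat as ℕ using (ℕ; zero; suc; NonZero; _%_; _≡ᵇ_)
open import Data.Fin as Fin using (Fin; zero; suc; splitAt; punchIn; _<_; toℕ)
open import Data.Fin.Properties using (_<?_)
import Data.Fin.Properties as FinP
open import Data.Bool using (Bool; true; false; not; _∧_; _∨_; T; if_then_else_)
open import Data.Sum using (_⊎_; inj₁; inj₂)
open import Data.Product using (Σ; ∃; ∃-syntax; _×_; _,_)
open import Data.Vec as Vec using (Vec; []; _∷_)
open import Data.Vec.Functional as VF using (Vector)
open import Data.List as List using (List; length; allFin; filterᵇ)
open import Data.List.Membership.Propositional using (_∈_)
open import Function.Bundles using (_↔_; Inverse; _⇔_)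
open import Relation.Binary.PropositionalEquality using (_≡_; _≢_)
open import Relation.Binary.Definitions using (DecidableEquality)
open import Relation.Nullary using (¬_; does)

record FiniteField : Set₁ where
  field
    commRing : CommutativeRing 0ℓ 0ℓ
  open CommutativeRing commRing public
  field
    ≈⇒≡      : ∀ {x y} → x ≈ y → x ≡ y
    0≢1      : ¬ (0# ≈ 1#)
    inverse  : ∀ x → ¬ (x ≈ 0#) → ∃[ y ] (x * y ≈ 1#)
    _≟F_     : DecidableEquality Carrier
    elements : List Carrier
    complete : ∀ x → x ∈ elements

record Signature : Set₁ where
  field
    Sym   : Set
    arity : Sym → ℕ
open Signature public

record Structure (Σ' : Signature) : Set where
  field
    size : ℕ
    rel  : (s : Sym Σ') → Vec (Fin size) (arity Σ' s) → Bool
open Structure public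

record _≅_ {Σ' : Signature} (A B : Structure Σ') : Set where
  field
    bij      : Fin (size A) ↔ Fin (size B)
  open Inverse bij using (to)
  field
    preserve : ∀ s (xs : Vec (Fin (size A)) (arity Σ' s)) →
               rel B s (Vec.map to xs) ≡ rel A s xs

data Formula (Σ' : Signature) (n : ℕ) : Set where
  atom  : (s : Sym Σ') → Vec (Fin n) (arity Σ' s) → Formula Σ' n
  equal : Fin n → Fin n → Formula Σ' n
  neg   : Formula Σ' n → Formula Σ' n
  conj  : Formula Σ' n → Formula Σ' n → Formula Σ' n
  disj  : Formula Σ' n → Formula Σ' n → Formula Σ' n
  exists : Formula Σ' (suc n) → Formula Σ' n
  forAll : Formula Σ' (suc n) → Formula Σ' n
  -- ∃^{i[p]} x ψ : the number of witnesses is ≡ i (mod p), p ≥ 1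
  existsMod : (i p : ℕ) → .{{NonZero p}} → Formula Σ' (suc n) → Formula Σ' n

count : ∀ {m} → (Fin m → Bool) → ℕ
count {zero}  f = 0
count {suc m} f = (if f zero then 1 else 0) ℕ.+ count (λ i → f (suc i))

⟦_⟧ : ∀ {Σ' n} → Formula Σ' n → (A : Structure Σ') → (Fin n → Fin (size A)) → Bool
⟦ atom s xs ⟧     A env = rel A s (Vec.map env xs)
⟦ equal x y ⟧     A env = does (env x Fin.≟ env y)
⟦ neg φ ⟧         A env = not (⟦ φ ⟧ A env)
⟦ conj φ ψ ⟧      A env = ⟦ φ ⟧ A env ∧ ⟦ ψ ⟧ A env
⟦ disj φ ψ ⟧      A env = ⟦ φ ⟧ A env ∨ ⟦ ψ ⟧ A env
⟦ exists φ ⟧      A env = not (count (λ v → ⟦ φ ⟧ A (v VF.∷ env)) ≡ᵇ 0)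
⟦ forAll φ ⟧      A env = count (λ v → not (⟦ φ ⟧ A (v VF.∷ env))) ≡ᵇ 0
⟦ existsMod i p φ ⟧ A env = (count (λ v → ⟦ φ ⟧ A (v VF.∷ env)) % p) ≡ᵇ (i % p)

record Interpretation (Σ' Γ : Signature) : Set where
  field
    ν : Formula Σ' 1
    ρ : (R : Sym Γ) → Formula Σ' (arity Γ R)
open Interpretation public

module _ {Σ' Γ : Signature} (I : Interpretation Σ' Γ) (A : Structure Σ') where
  interpDomain : List (Fin (size A))
  interpDomain = filterᵇ (λ v → ⟦ ν I ⟧ A (λ _ → v)) (allFin (size A))

  apply : Structure Γ
  apply = record
    { size = length interpDomain
    ; rel  = λ R xs → ⟦ ρ I R ⟧ A (λ i → List.lookup interpDomain (Vec.lookup xs i))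
    }

_+U_ : Signature → ℕ → Signature
Σ' +U k = record { Sym = Sym Σ' ⊎ Fin k ; arity = λ { (inj₁ s) → arity Σ' s ; (inj₂ _) → 1 } }

expand : ∀ {Σ'} (A : Structure Σ') (k : ℕ) → (Fin k → Fin (size A) → Bool) → Structure (Σ' +U k)
expand A k col = record
  { size = size A
  ; rel  = λ { (inj₁ s) xs → rel A s xs ; (inj₂ j) xs → col j (Vec.head xs) } }

record Transduction (Σ' Γ : Signature) : Set where
  field
    k      : ℕ
    interp : Interpretation (Σ' +U k) Γ
open Transduction public

_∈T_ : ∀ {Σ' Γ} → Structure Γ → Transduction Σ' Γ × Structure Σ' → Set
B ∈T (T , A) = ∃[ col ] (B ≅ apply (interp T) (expand A (k T) col))

module Matrices (F : FiniteField) where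
  open FiniteField F

  Matrix : ℕ → ℕ → Set
  Matrix r c = Fin r → Fin c → Carrier

  data MSym : Set where
    rowSym : MSym
    ltSym  : MSym
    entSym : (a : Carrier) → T (not (does (a ≟F 0#))) → MSym

  MSig : Signature
  MSig = record
    { Sym = MSym
    ; arity = λ { rowSym → 1 ; ltSym → 2 ; (entSym _ _) → 2 } }

  isRow : ∀ {r c} → Fin (r ℕ.+ c) → Bool
  isRow {r} x with splitAt r x
  ... | inj₁ _ = true
  ... | inj₂ _ = false

  entry : ∀ {r c} → Matrix r c → Carrier → Fin (r ℕ.+ c) → Fin (r ℕ.+ c) → Bool
  entry {r} M a x y with splitAt r x | splitAt r y
  ... | inj₁ i | inj₂ j = does (M i j ≟F a)
  ... | _      | _      = false

  -- domain R ⊎ C = Fin (r + c): rows 0..r-1, then columns;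
  -- the total order is the strict order of Fin (r + c)
  encode : ∀ {r c} → Matrix r c → Structure MSig
  encode {r} {c} M = record
    { size = r ℕ.+ c
    ; rel  = λ { rowSym (x ∷ []) → isRow {r} {c} x
               ; ltSym (x ∷ y ∷ []) → does (x <? y)
               ; (entSym a _) (x ∷ y ∷ []) → entry M a x y } }

  StrictlyIncreasing : ∀ {m n} → (Fin m → Fin n) → Set
  StrictlyIncreasing f = ∀ {i j} → i < j → f i < f j

  IsSubmatrix : ∀ {r' c' r c} → Matrix r' c' → Matrix r c → Set
  IsSubmatrix {r'} {c'} {r} {c} N M =
    Σ (Fin r' → Fin r) λ f → Σ (Fin c' → Fin c) λ g →
      StrictlyIncreasing f × StrictlyIncreasing g × (∀ i j → N i j ≡ M (f i) (g j))

  record MatrixClass : Set₁ where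
    field
      member    : ∀ {r c} → Matrix r c → Set
      hereditary : ∀ {r' c' r c} {N : Matrix r' c'} {M : Matrix r c} →
                   member M → IsSubmatrix N M → member N
  open MatrixClass public

  deleteRow : ∀ {r c} → Fin (suc r) → Matrix (suc r) c → Matrix r c
  deleteRow i M k j = M (punchIn i k) j

  deleteCol : ∀ {r c} → Fin (suc c) → Matrix r (suc c) → Matrix r c
  deleteCol j M i l = M i (punchIn j l)

  -- rows i and i+1 replaced by their sum, placed at position i
  sumRows : ∀ {r c} → Fin r → Matrix (suc r) c → Matrix r c
  sumRows i M k j with k Fin.≟ i
  ... | Relation.Nullary.yes _ = M (Fin.inject₁ i) j + M (suc i) j
  ... | Relation.Nullary.no  _ = M (punchIn (suc i) k) j

  sumCols : ∀ {r c} → Fin c → Matrix r (suc c) → Matrix r c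
  sumCols j M i l with l Fin.≟ j
  ... | Relation.Nullary.yes _ = M i (Fin.inject₁ j) + M i (suc j)
  ... | Relation.Nullary.no  _ = M i (punchIn (suc j) l)

  data ParityMinor : ∀ {r' c' r c} → Matrix r' c' → Matrix r c → Set where
    done   : ∀ {r c} {M : Matrix r c} → ParityMinor M M
    delR   : ∀ {r' c' r c} {N : Matrix r' c'} {M : Matrix (suc r) c} (i : Fin (suc r)) →
             ParityMinor N (deleteRow i M) → ParityMinor N M
    delC   : ∀ {r' c' r c} {N : Matrix r' c'} {M : Matrix r (suc c)} (j : Fin (suc c)) →
             ParityMinor N (deleteCol j M) → ParityMinor N M
    sumR   : ∀ {r' c' r c} {N : Matrix r' c'} {M : Matrix (suc r) c} (i : Fin r) →
             ParityMinor N (sumRows i M) → ParityMinor N M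
    sumC   : ∀ {r' c' r c} {N : Matrix r' c'} {M : Matrix r (suc c)} (j : Fin c) →
             ParityMinor N (sumCols j M) → ParityMinor N M

  InImage : Transduction MSig MSig → MatrixClass → Structure MSig → Set
  InImage T 𝓜 B = ∃[ r ] ∃[ c ] Σ (Matrix r c) λ M → member 𝓜 M × (B ∈T (T , encode M))

  InPMClosure : MatrixClass → Structure MSig → Set
  InPMClosure 𝓜 B =
    ∃[ r ] ∃[ c ] Σ (Matrix r c) λ M → ∃[ r' ] ∃[ c' ] Σ (Matrix r' c') λ N →
      member 𝓜 M × ParityMinor N M × (B ≅ encode N)

{-# OPTIONS --safe #-}
-- A sequence of deletions and sums of consecutive lines acts on rows and on columns
-- independently, and on each side it has a normal form: every line is deleted, added to the
-- next kept line, or kept.  So the parity minors of M are described by two colours on its rows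
-- and columns, kept and added.  The transduction guesses them, keeps the kept elements, and
-- gives a kept row x and a kept column y the sum of M over (block of x) × (block of y), a block
-- being a kept line together with the added lines summed into it.  Over a finite field this sum
-- is FO+MOD-definable: it is Σ_d #{summands equal to d} · d, and for χ > 0 with χ · 1 = 0 only
-- these numbers modulo χ matter.
module Submission where

open import Defs
open import Data.Bool using (Bool; true; false; not; _∧_; _∨_; if_then_else_; T)
open import Data.Bool.Properties using (not-involutive; ∨-identityʳ)
open import Data.Fin as Fin using (Fin; zero; suc; toℕ; _↑ˡ_; _↑ʳ_; splitAt; punchIn)
open import Data.Fin.Properties using (_<?_)
import Data.Fin.Properties as FinP
open import Data.List as List using (List; []; _∷_; length; filterᵇ; deduplicate)
open import Data.List.Membership.Propositional using (_∈_)
open import Data.List.Membership.Propositional.Properties using (∈-deduplicate⁺)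
import Data.List.Relation.Unary.All as All
open import Data.List.Relation.Unary.AllPairs using (_∷_)
import Data.List.Relation.Unary.Any as Any
open import Data.List.Relation.Unary.Any using (here; there)
open import Data.List.Relation.Unary.Any.Properties using (lookup-index)
open import Data.List.Relation.Unary.Unique.Propositional using (Unique)
open import Data.List.Relation.Unary.Unique.DecPropositional.Properties using (deduplicate-!)
open import Data.Nat as ℕ using (ℕ; zero; suc; _≡ᵇ_; _%_; _/_)
open import Data.Nat.DivMod using (m≡m%n+[m/n]*n; m%n%n≡m%n; m%n<n; m<n⇒m%n≡m)
import Data.Nat.Properties as ℕP
open import Data.Product using (Σ; ∃-syntax; _×_; _,_; proj₁; proj₂)
open import Data.Sum as Sum using (inj₁; inj₂)
open import Data.Vec as Vec using ([]; _∷_)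
import Data.Vec.Functional as VF
import Data.Vec.Properties as VecP
open import Function using (_∘_; _⇔_; Inverse; mk↔ₛ′; mk⇔)
open import Function.Construct.Composition using (_↔-∘_)
open import Function.Construct.Identity using (↔-id)
open import Function.Construct.Symmetry using (↔-sym)
open import Relation.Binary.Definitions using (tri<; tri≈; tri>)
open import Relation.Binary.PropositionalEquality
open import Relation.Nullary using (does; yes; no; contradiction)
open import Relation.Nullary.Decidable using (dec-true; dec-false; does-⇔)

indicator : Bool → ℕ
indicator b = if b then 1 else 0

count-cong : ∀ {n} {f g : Fin n → Bool} → f ≗ g → count f ≡ count g
count-cong {zero}  f≗g = refl
count-cong {suc n} f≗g = cong₂ ℕ._+_ (cong indicator (f≗g zero)) (count-cong (f≗g ∘ suc))

count-false : ∀ n → count {n} (λ _ → false) ≡ 0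
count-false zero    = refl
count-false (suc n) = count-false n

count-↑ : ∀ m n (f : Fin (m ℕ.+ n) → Bool) →
          count f ≡ count (f ∘ (_↑ˡ n)) ℕ.+ count (f ∘ (m ↑ʳ_))
count-↑ zero    n f = refl
count-↑ (suc m) n f = begin
  indicator (f zero) ℕ.+ count (f ∘ suc)
    ≡⟨ cong (indicator (f zero) ℕ.+_) (count-↑ m n (f ∘ suc)) ⟩
  indicator (f zero) ℕ.+ (count (f ∘ suc ∘ (_↑ˡ n)) ℕ.+ count (f ∘ suc ∘ (m ↑ʳ_)))
    ≡⟨ ℕP.+-assoc (indicator (f zero)) _ _ ⟨
  count (f ∘ (_↑ˡ n)) ℕ.+ count (f ∘ (suc m ↑ʳ_)) ∎
  where open ≡-Reasoning

select : ∀ {n} (p : Fin n → Bool) → Fin (count p) → Fin n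
select {suc n} p k with p zero
select {suc n} p zero    | true  = zero
select {suc n} p (suc k) | true  = suc (select (p ∘ suc) k)
select {suc n} p k       | false = suc (select (p ∘ suc) k)

select-increasing : ∀ {n} (p : Fin n → Bool) {i j} → i Fin.< j → select p i Fin.< select p j
select-increasing {suc n} p {i} {j} i<j with p zero
select-increasing {suc n} p {zero}  {suc j} i<j | true  = ℕ.s≤s ℕ.z≤n
select-increasing {suc n} p {suc i} {suc j} i<j | true  = ℕ.s≤s (select-increasing (p ∘ suc) (ℕP.≤-pred i<j))
select-increasing {suc n} p {i}     {j}     i<j | false = ℕ.s≤s (select-increasing (p ∘ suc) i<j)

count-below-select : ∀ {n} (p : Fin n → Bool) (k : Fin (count p)) →
                     count (λ v → does (v <? select p k) ∧ p v) ≡ toℕ k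
count-below-select {suc n} p k with p zero
count-below-select {suc n} p zero    | true  = count-false n
count-below-select {suc n} p (suc k) | true  = cong suc (count-below-select (p ∘ suc) k)
count-below-select {suc n} p k       | false = count-below-select (p ∘ suc) k

length-filterᵇ-tabulate : ∀ {A : Set} n (f : Fin n → A) (p : A → Bool) →
                          length (filterᵇ p (List.tabulate f)) ≡ count (p ∘ f)
length-filterᵇ-tabulate zero    f p = refl
length-filterᵇ-tabulate (suc n) f p with p (f zero)
... | true  = cong suc (length-filterᵇ-tabulate n (f ∘ suc) p)
... | false = length-filterᵇ-tabulate n (f ∘ suc) p

lookup-filterᵇ-tabulate : ∀ {A : Set} n (f : Fin n → A) (p : A → Bool) k →
  List.lookup (filterᵇ p (List.tabulate f)) k ≡ f (select (p ∘ f) (Fin.cast (length-filterᵇ-tabulate n f p) k))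
lookup-filterᵇ-tabulate (suc n) f p k with p (f zero)
lookup-filterᵇ-tabulate (suc n) f p zero    | true  = refl
lookup-filterᵇ-tabulate (suc n) f p (suc k) | true  = lookup-filterᵇ-tabulate n (f ∘ suc) p k
lookup-filterᵇ-tabulate (suc n) f p k       | false = lookup-filterᵇ-tabulate n (f ∘ suc) p k

≟-↑ˡ : ∀ {m} n (i j : Fin m) → does (i ↑ˡ n Fin.≟ j ↑ˡ n) ≡ does (i Fin.≟ j)
≟-↑ˡ n i j = does-⇔ (mk⇔ (FinP.↑ˡ-injective n i j) (cong (_↑ˡ n))) (i ↑ˡ n Fin.≟ j ↑ˡ n) (i Fin.≟ j)

≟-↑ʳ : ∀ {n} m (i j : Fin n) → does (m ↑ʳ i Fin.≟ m ↑ʳ j) ≡ does (i Fin.≟ j)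
≟-↑ʳ m i j = does-⇔ (mk⇔ (FinP.↑ʳ-injective m i j) (cong (m ↑ʳ_))) (m ↑ʳ i Fin.≟ m ↑ʳ j) (i Fin.≟ j)

↑ˡ<↑ʳ : ∀ {m n} (i : Fin m) (j : Fin n) → i ↑ˡ n Fin.< m ↑ʳ j
↑ˡ<↑ʳ {m} {n} i j rewrite FinP.toℕ-↑ˡ i n | FinP.toℕ-↑ʳ m j = ℕP.<-≤-trans (FinP.toℕ<n i) (ℕP.m≤m+n m (toℕ j))

<?-↑ˡ↑ʳ : ∀ {m n} (i : Fin m) (j : Fin n) → does (i ↑ˡ n <? m ↑ʳ j) ≡ true
<?-↑ˡ↑ʳ i j = dec-true (_ <? _) (↑ˡ<↑ʳ i j)

<?-↑ʳ↑ˡ : ∀ {m n} (i : Fin m) (j : Fin n) → does (m ↑ʳ j <? i ↑ˡ n) ≡ false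
<?-↑ʳ↑ˡ i j = dec-false (_ <? _) (ℕP.<-asym (↑ˡ<↑ʳ i j))

<?-↑ˡ : ∀ {m} n (i j : Fin m) → does (i ↑ˡ n <? j ↑ˡ n) ≡ does (i <? j)
<?-↑ˡ n i j = does-⇔ (mk⇔ (subst₂ ℕ._<_ (FinP.toℕ-↑ˡ i n) (FinP.toℕ-↑ˡ j n))
                          (subst₂ ℕ._<_ (sym (FinP.toℕ-↑ˡ i n)) (sym (FinP.toℕ-↑ˡ j n))))
                     (i ↑ˡ n <? j ↑ˡ n) (i <? j)

<?-↑ʳ : ∀ {n} m (i j : Fin n) → does (m ↑ʳ i <? m ↑ʳ j) ≡ does (i <? j)
<?-↑ʳ m i j = does-⇔ (mk⇔ (ℕP.+-cancelˡ-< m _ _ ∘ subst₂ ℕ._<_ (FinP.toℕ-↑ʳ m i) (FinP.toℕ-↑ʳ m j))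
                          (subst₂ ℕ._<_ (sym (FinP.toℕ-↑ʳ m i)) (sym (FinP.toℕ-↑ʳ m j)) ∘ ℕP.+-monoʳ-< m))
                     (m ↑ʳ i <? m ↑ʳ j) (i <? j)

select-↑ : ∀ m n (p : Fin (m ℕ.+ n) → Bool) (t : Fin (count p))
           (u : Fin (count (p ∘ (_↑ˡ n)) ℕ.+ count (p ∘ (m ↑ʳ_)))) → toℕ t ≡ toℕ u →
           select p t ≡ Fin.join m n (Sum.map (select (p ∘ (_↑ˡ n))) (select (p ∘ (m ↑ʳ_))) (splitAt _ u))
select-↑ zero    n p t u e = cong (select p) (FinP.toℕ-injective e)
select-↑ (suc m) n p t u e with p zero
select-↑ (suc m) n p zero    zero    e | true = refl
select-↑ (suc m) n p (suc t) (suc u) e | true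
  with splitAt (count (p ∘ suc ∘ (_↑ˡ n))) u | select-↑ m n (p ∘ suc) t u (ℕP.suc-injective e)
... | inj₁ _ | ih = cong suc ih
... | inj₂ _ | ih = cong suc ih
select-↑ (suc m) n p t u e | false
  with splitAt (count (p ∘ suc ∘ (_↑ˡ n))) u | select-↑ m n (p ∘ suc) t u e
... | inj₁ _ | ih = cong suc ih
... | inj₂ _ | ih = cong suc ih

increasing⇒<?-preserved : ∀ {m n} (f : Fin m → Fin n) → (∀ {a b} → a Fin.< b → f a Fin.< f b) →
                          ∀ a b → does (f a <? f b) ≡ does (a <? b)
increasing⇒<?-preserved f increasing a b = does-⇔ (mk⇔ reflects increasing) (f a <? f b) (a <? b)
  where
  reflects : f a Fin.< f b → a Fin.< b
  reflects fa<fb with FinP.<-cmp a b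
  ... | tri< a<b _ _ = a<b
  ... | tri≈ _ refl _ = contradiction fa<fb (ℕP.<-irrefl refl)
  ... | tri> _ _ b<a = contradiction fa<fb (ℕP.<-asym (increasing b<a))

<?-cast : ∀ {m n} .(e : m ≡ n) (x y : Fin m) → does (Fin.cast e x <? Fin.cast e y) ≡ does (x <? y)
<?-cast e x y rewrite FinP.toℕ-cast e x | FinP.toℕ-cast e y = refl

noKeptBetween : ∀ {n} → (Fin n → Bool) → Fin n → Fin n → Bool
noKeptBetween kept z x = count (λ v → does (z <? v) ∧ does (v <? x) ∧ kept v) ≡ᵇ 0

-- the entries that `wordOf kept added` sums into the kept entry x
inBlock : ∀ {n} (kept added : Fin n → Bool) (x z : Fin n) → Bool
inBlock kept added x z =
  does (z Fin.≟ x) ∨ (does (z <? x) ∧ not (kept z) ∧ added z ∧ noKeptBetween kept z x)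

noKeptBetween-↑ˡ : ∀ {m} n (kept : Fin (m ℕ.+ n) → Bool) (z x : Fin m) →
                   noKeptBetween kept (z ↑ˡ n) (x ↑ˡ n) ≡ noKeptBetween (kept ∘ (_↑ˡ n)) z x
noKeptBetween-↑ˡ {m} n kept z x = cong (_≡ᵇ 0) (trans (count-↑ m n _)
  (trans (cong₂ ℕ._+_ (count-cong between) (trans (count-cong notBetween) (count-false n))) (ℕP.+-identityʳ _)))
  where
  between : ∀ v → (does (z ↑ˡ n <? v ↑ˡ n) ∧ does (v ↑ˡ n <? x ↑ˡ n) ∧ kept (v ↑ˡ n))
                ≡ (does (z <? v) ∧ does (v <? x) ∧ kept (v ↑ˡ n))
  between v = cong₂ (λ a b → a ∧ b ∧ kept (v ↑ˡ n)) (<?-↑ˡ n z v) (<?-↑ˡ n v x)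
  notBetween : ∀ v → (does (z ↑ˡ n <? m ↑ʳ v) ∧ does (m ↑ʳ v <? x ↑ˡ n) ∧ kept (m ↑ʳ v)) ≡ false
  notBetween v rewrite <?-↑ˡ↑ʳ z v | <?-↑ʳ↑ˡ x v = refl

noKeptBetween-↑ʳ : ∀ m {n} (kept : Fin (m ℕ.+ n) → Bool) (z x : Fin n) →
                   noKeptBetween kept (m ↑ʳ z) (m ↑ʳ x) ≡ noKeptBetween (kept ∘ (m ↑ʳ_)) z x
noKeptBetween-↑ʳ m {n} kept z x = cong (_≡ᵇ 0) (trans (count-↑ m n _)
  (cong₂ ℕ._+_ (trans (count-cong notBetween) (count-false m)) (count-cong between)))
  where
  between : ∀ v → (does (m ↑ʳ z <? m ↑ʳ v) ∧ does (m ↑ʳ v <? m ↑ʳ x) ∧ kept (m ↑ʳ v))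
                ≡ (does (z <? v) ∧ does (v <? x) ∧ kept (m ↑ʳ v))
  between v = cong₂ (λ a b → a ∧ b ∧ kept (m ↑ʳ v)) (<?-↑ʳ m z v) (<?-↑ʳ m v x)
  notBetween : ∀ v → (does (m ↑ʳ z <? v ↑ˡ n) ∧ does (v ↑ˡ n <? m ↑ʳ x) ∧ kept (v ↑ˡ n)) ≡ false
  notBetween v rewrite <?-↑ʳ↑ˡ v z = refl

inBlock-↑ˡ : ∀ {m} n (kept added : Fin (m ℕ.+ n) → Bool) (x z : Fin m) →
             inBlock kept added (x ↑ˡ n) (z ↑ˡ n) ≡ inBlock (kept ∘ (_↑ˡ n)) (added ∘ (_↑ˡ n)) x z
inBlock-↑ˡ n kept added x z
  rewrite ≟-↑ˡ n z x | <?-↑ˡ n z x | noKeptBetween-↑ˡ n kept z x = refl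

inBlock-↑ʳ : ∀ m {n} (kept added : Fin (m ℕ.+ n) → Bool) (x z : Fin n) →
             inBlock kept added (m ↑ʳ x) (m ↑ʳ z) ≡ inBlock (kept ∘ (m ↑ʳ_)) (added ∘ (m ↑ʳ_)) x z
inBlock-↑ʳ m kept added x z
  rewrite ≟-↑ʳ m z x | <?-↑ʳ m z x | noKeptBetween-↑ʳ m kept z x = refl

≅-sym : ∀ {Σ'} {A B : Structure Σ'} → A ≅ B → B ≅ A
≅-sym {A = A} {B} A≅B = record { bij = ↔-sym bij ; preserve = preserve⁻¹ }
  where
  open _≅_ A≅B
  open Inverse bij
  preserve⁻¹ : ∀ s ys → rel A s (Vec.map from ys) ≡ rel B s ys
  preserve⁻¹ s ys = begin
    rel A s (Vec.map from ys)                 ≡⟨ preserve s (Vec.map from ys) ⟨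
    rel B s (Vec.map to (Vec.map from ys))    ≡⟨ cong (rel B s) (VecP.map-∘ to from ys) ⟨
    rel B s (Vec.map (to ∘ from) ys)          ≡⟨ cong (rel B s) (VecP.map-cong strictlyInverseˡ ys) ⟩
    rel B s (Vec.map (λ y → y) ys)            ≡⟨ cong (rel B s) (VecP.map-id ys) ⟩
    rel B s ys                                ∎
    where open ≡-Reasoning

≅-trans : ∀ {Σ'} {A B C : Structure Σ'} → A ≅ B → B ≅ C → A ≅ C
≅-trans {A = A} {B} {C} A≅B B≅C = record { bij = _≅_.bij B≅C ↔-∘ _≅_.bij A≅B ; preserve = preserve }
  where
  f = Inverse.to (_≅_.bij A≅B)
  g = Inverse.to (_≅_.bij B≅C)
  preserve : ∀ s xs → rel C s (Vec.map (g ∘ f) xs) ≡ rel A s xs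
  preserve s xs = begin
    rel C s (Vec.map (g ∘ f) xs)       ≡⟨ cong (rel C s) (VecP.map-∘ g f xs) ⟩
    rel C s (Vec.map g (Vec.map f xs)) ≡⟨ _≅_.preserve B≅C s (Vec.map f xs) ⟩
    rel B s (Vec.map f xs)             ≡⟨ _≅_.preserve A≅B s xs ⟩
    rel A s xs                         ∎
    where open ≡-Reasoning

module _ {Σ' : Signature} where

  ⊤ᶠ : ∀ {n} → Formula Σ' n
  ⊤ᶠ = forAll (equal zero zero)

  ⊥ᶠ : ∀ {n} → Formula Σ' n
  ⊥ᶠ = neg ⊤ᶠ

  ⊤ᶠ-sem : ∀ {n} (A : Structure Σ') (env : Fin n → Fin (size A)) → ⟦ ⊤ᶠ ⟧ A env ≡ true
  ⊤ᶠ-sem A env = cong (_≡ᵇ 0)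
    (trans (count-cong {size A} (λ v → cong not (dec-true (v Fin.≟ v) refl))) (count-false (size A)))

  ⊥ᶠ-sem : ∀ {n} (A : Structure Σ') (env : Fin n → Fin (size A)) → ⟦ ⊥ᶠ ⟧ A env ≡ false
  ⊥ᶠ-sem A env = cong not (⊤ᶠ-sem A env)

  ⋁< : ∀ {n} → ℕ → (ℕ → Formula Σ' n) → Formula Σ' n
  ⋁< zero    φ = ⊥ᶠ
  ⋁< (suc m) φ = disj (φ m) (⋁< m φ)

  ⋁<-false : ∀ {n} (A : Structure Σ') env m (φ : ℕ → Formula Σ' n) →
             (∀ k → k ℕ.< m → ⟦ φ k ⟧ A env ≡ false) → ⟦ ⋁< m φ ⟧ A env ≡ false
  ⋁<-false A env zero    φ all-false = ⊥ᶠ-sem A env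
  ⋁<-false A env (suc m) φ all-false rewrite all-false m (ℕP.n<1+n m) =
    ⋁<-false A env m φ (λ k k<m → all-false k (ℕP.m<n⇒m<1+n k<m))

  ⋁<-single : ∀ {n} (A : Structure Σ') env m (φ : ℕ → Formula Σ' n) k₀ → k₀ ℕ.< m →
              (∀ k → k ℕ.< m → k ≢ k₀ → ⟦ φ k ⟧ A env ≡ false) →
              ⟦ ⋁< m φ ⟧ A env ≡ ⟦ φ k₀ ⟧ A env
  ⋁<-single A env (suc m) φ k₀ k₀<1+m others with m ℕ.≟ k₀
  ... | yes refl rewrite ⋁<-false A env m φ (λ k k<m → others k (ℕP.m<n⇒m<1+n k<m) (ℕP.<⇒≢ k<m)) =
    ∨-identityʳ _
  ... | no m≢k₀ rewrite others m (ℕP.n<1+n m) m≢k₀ =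
    ⋁<-single A env m φ k₀ (ℕP.≤∧≢⇒< (ℕP.≤-pred k₀<1+m) (m≢k₀ ∘ sym))
              (λ k k<m → others k (ℕP.m<n⇒m<1+n k<m))

module _ (F : FiniteField) where
  open FiniteField F
    using ( Carrier; _+_; _*_; -_; 0#; 1#; _≟F_; ≈⇒≡; reflexive; elements; complete
          ; +-assoc; +-identityˡ; +-identityʳ; *-identityˡ; zeroˡ
          ; +-rawMonoid; +-monoid; +-commutativeSemigroup; +-group; semiring )
  open Matrices F
  open import Algebra.Definitions.RawMonoid +-rawMonoid using (sum) renaming (_×_ to _·_)
  open import Algebra.Properties.Monoid.Sum +-monoid using (sum-replicate-zero; sum-cong-≗)
  open import Algebra.Properties.Monoid.Mult +-monoid using (×-homo-+; ×-assocˡ)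
  open import Algebra.Properties.Semiring.Mult semiring using (×-assoc-*)
  import Algebra.Properties.Group +-group as +-G
  import Algebra.Properties.CommutativeSemigroup +-commutativeSemigroup as +-CS

  +-interchange : ∀ a b c d → (a + b) + (c + d) ≡ (a + c) + (b + d)
  +-interchange a b c d = ≈⇒≡ (+-CS.interchange a b c d)

  e₀ : ∀ {n} → Carrier → Fin n → Carrier
  e₀ a zero    = a
  e₀ a (suc _) = 0#

  e₀-+ : ∀ {n} a b (k : Fin n) → e₀ (a + b) k ≡ e₀ a k + e₀ b k
  e₀-+ a b zero    = refl
  e₀-+ a b (suc k) = sym (≈⇒≡ (+-identityˡ 0#))

  sumAt : ∀ {r} → Fin r → (Fin (suc r) → Carrier) → Fin r → Carrier
  sumAt i v k with k Fin.≟ i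
  ... | yes _ = v (Fin.inject₁ i) + v (suc i)
  ... | no  _ = v (punchIn (suc i) k)

  sumAt-cong : ∀ {r} (i : Fin r) {v v′} → v ≗ v′ → sumAt i v ≗ sumAt i v′
  sumAt-cong i v≗v′ k with k Fin.≟ i
  ... | yes _ = cong₂ _+_ (v≗v′ _) (v≗v′ _)
  ... | no  _ = v≗v′ _

  sumAt-suc : ∀ {r} (i : Fin r) v → VF.tail (sumAt (suc i) v) ≗ sumAt i (VF.tail v)
  sumAt-suc i v k with k Fin.≟ i
  ... | yes _ = refl
  ... | no  _ = refl

  -- The normal form of a sequence of deletions and sums of consecutive entries:
  -- each entry is deleted (skip), added to the next kept entry (add), or kept (keep).
  data Word : ℕ → ℕ → Set where
    []   : Word 0 0
    skip : ∀ {r r′} → Word r r′ → Word (suc r) r′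
    add  : ∀ {r r′} → Word r r′ → Word (suc r) r′
    keep : ∀ {r r′} → Word r r′ → Word (suc r) (suc r′)

  reduce : ∀ {r r′} → Word r r′ → (Fin r → Carrier) → Fin r′ → Carrier
  reduce (skip w) v k       = reduce w (VF.tail v) k
  reduce (add w)  v k       = e₀ (v zero) k + reduce w (VF.tail v) k
  reduce (keep w) v zero    = v zero
  reduce (keep w) v (suc k) = reduce w (VF.tail v) k

  reduce-cong : ∀ {r r′} (w : Word r r′) {v v′} → v ≗ v′ → reduce w v ≗ reduce w v′
  reduce-cong (skip w) v≗v′ k       = reduce-cong w (v≗v′ ∘ suc) k
  reduce-cong (add w)  v≗v′ k       = cong₂ _+_ (cong (λ a → e₀ a k) (v≗v′ zero)) (reduce-cong w (v≗v′ ∘ suc) k)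
  reduce-cong (keep w) v≗v′ zero    = v≗v′ zero
  reduce-cong (keep w) v≗v′ (suc k) = reduce-cong w (v≗v′ ∘ suc) k

  reduce-+ : ∀ {r r′} (w : Word r r′) (v v′ : Fin r → Carrier) →
             reduce w (λ z → v z + v′ z) ≗ (λ k → reduce w v k + reduce w v′ k)
  reduce-+ (skip w) v v′ k       = reduce-+ w (VF.tail v) (VF.tail v′) k
  reduce-+ (add w)  v v′ k       = begin
    e₀ (v zero + v′ zero) k + reduce w _ k
      ≡⟨ cong₂ _+_ (e₀-+ (v zero) (v′ zero) k) (reduce-+ w (VF.tail v) (VF.tail v′) k) ⟩
    (e₀ (v zero) k + e₀ (v′ zero) k) + (reduce w (VF.tail v) k + reduce w (VF.tail v′) k)
      ≡⟨ +-interchange _ _ _ _ ⟩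
    (e₀ (v zero) k + reduce w (VF.tail v) k) + (e₀ (v′ zero) k + reduce w (VF.tail v′) k) ∎
    where open ≡-Reasoning
  reduce-+ (keep w) v v′ zero    = refl
  reduce-+ (keep w) v v′ (suc k) = reduce-+ w (VF.tail v) (VF.tail v′) k

  keepAll : ∀ r → Word r r
  keepAll zero    = []
  keepAll (suc r) = keep (keepAll r)

  reduce-keepAll : ∀ r v → reduce (keepAll r) v ≗ v
  reduce-keepAll (suc r) v zero    = refl
  reduce-keepAll (suc r) v (suc k) = reduce-keepAll r (VF.tail v) k

  insertSkip : ∀ {r r′} → Fin (suc r) → Word r r′ → Word (suc r) r′
  insertSkip zero    w        = skip w
  insertSkip (suc i) (skip w) = skip (insertSkip i w)
  insertSkip (suc i) (add w)  = add (insertSkip i w)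
  insertSkip (suc i) (keep w) = keep (insertSkip i w)

  reduce-insertSkip : ∀ {r r′} (i : Fin (suc r)) (w : Word r r′) v →
                      reduce (insertSkip i w) v ≗ reduce w (VF.removeAt v i)
  reduce-insertSkip zero    w        v k       = refl
  reduce-insertSkip (suc i) (skip w) v k       = reduce-insertSkip i w (VF.tail v) k
  reduce-insertSkip (suc i) (add w)  v k       = cong (e₀ (v zero) k +_) (reduce-insertSkip i w (VF.tail v) k)
  reduce-insertSkip (suc i) (keep w) v zero    = refl
  reduce-insertSkip (suc i) (keep w) v (suc k) = reduce-insertSkip i w (VF.tail v) k

  unmerge : ∀ {r r′} → Fin r → Word r r′ → Word (suc r) r′
  unmerge zero    (skip w) = skip (skip w)
  unmerge zero    (add w)  = add (add w)
  unmerge zero    (keep w) = add (keep w)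
  unmerge (suc i) (skip w) = skip (unmerge i w)
  unmerge (suc i) (add w)  = add (unmerge i w)
  unmerge (suc i) (keep w) = keep (unmerge i w)

  reduce-unmerge : ∀ {r r′} (i : Fin r) (w : Word r r′) v → reduce (unmerge i w) v ≗ reduce w (sumAt i v)
  reduce-unmerge zero    (skip w) v k       = refl
  reduce-unmerge zero    (add w)  v k       = begin
    e₀ (v zero) k + (e₀ (v (suc zero)) k + reduce w _ k)  ≡⟨ ≈⇒≡ (+-assoc _ _ _) ⟨
    (e₀ (v zero) k + e₀ (v (suc zero)) k) + reduce w _ k  ≡⟨ cong (_+ reduce w (VF.tail (VF.tail v)) k) (e₀-+ _ _ k) ⟨
    e₀ (v zero + v (suc zero)) k + reduce w _ k           ∎
    where open ≡-Reasoning
  reduce-unmerge zero    (keep w) v zero    = refl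
  reduce-unmerge zero    (keep w) v (suc k) = ≈⇒≡ (+-identityˡ _)
  reduce-unmerge (suc i) (skip w) v k       =
    trans (reduce-unmerge i w (VF.tail v) k) (reduce-cong w (sym ∘ sumAt-suc i v) k)
  reduce-unmerge (suc i) (add w)  v k       =
    cong (e₀ (v zero) k +_) (trans (reduce-unmerge i w (VF.tail v) k) (reduce-cong w (sym ∘ sumAt-suc i v) k))
  reduce-unmerge (suc i) (keep w) v zero    = refl
  reduce-unmerge (suc i) (keep w) v (suc k) =
    trans (reduce-unmerge i w (VF.tail v) k) (reduce-cong w (sym ∘ sumAt-suc i v) k)

  data Ops : ℕ → ℕ → Set where
    done  : ∀ {r} → Ops r r
    del   : ∀ {r r′} → Fin (suc r) → Ops r r′ → Ops (suc r) r′
    merge : ∀ {r r′} → Fin r → Ops r r′ → Ops (suc r) r′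

  runOps : ∀ {r r′} → Ops r r′ → (Fin r → Carrier) → Fin r′ → Carrier
  runOps done        v = v
  runOps (del i o)   v = runOps o (VF.removeAt v i)
  runOps (merge i o) v = runOps o (sumAt i v)

  runOps-cong : ∀ {r r′} (o : Ops r r′) {v v′} → v ≗ v′ → runOps o v ≗ runOps o v′
  runOps-cong done        v≗v′ = v≗v′
  runOps-cong (del i o)   v≗v′ = runOps-cong o (v≗v′ ∘ punchIn i)
  runOps-cong (merge i o) v≗v′ = runOps-cong o (sumAt-cong i v≗v′)

  shift : ∀ {r r′} → Ops r r′ → Ops (suc r) (suc r′)
  shift done        = done
  shift (del i o)   = del (suc i) (shift o)
  shift (merge i o) = merge (suc i) (shift o)

  runOps-shift : ∀ {r r′} (o : Ops r r′) v → runOps (shift o) v ≗ v zero VF.∷ runOps o (VF.tail v)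
  runOps-shift done        v zero    = refl
  runOps-shift done        v (suc k) = refl
  runOps-shift (del i o)   v k       = trans (runOps-shift o _ k) (head∷tail k)
    where
    head∷tail : v zero VF.∷ runOps o (VF.tail (VF.removeAt v (suc i)))
              ≗ v zero VF.∷ runOps o (VF.removeAt (VF.tail v) i)
    head∷tail zero    = refl
    head∷tail (suc k) = refl
  runOps-shift (merge i o) v k       = trans (runOps-shift o _ k) (head∷tail k)
    where
    head∷tail : sumAt (suc i) v zero VF.∷ runOps o (VF.tail (sumAt (suc i) v))
              ≗ v zero VF.∷ runOps o (sumAt i (VF.tail v))
    head∷tail zero    = refl
    head∷tail (suc k) = runOps-cong o (sumAt-suc i v) k

  mutual
    opsOf : ∀ {r r′} → Word r r′ → Ops r r′
    opsOf []       = done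
    opsOf (skip w) = del zero (opsOf w)
    opsOf (add w)  = opsOfAdd w
    opsOf (keep w) = shift (opsOf w)

    -- moves the leading added entry forward until it meets the next kept entry
    opsOfAdd : ∀ {r r′} → Word r r′ → Ops (suc r) r′
    opsOfAdd []       = del zero done
    opsOfAdd (skip w) = del (suc zero) (opsOfAdd w)
    opsOfAdd (add w)  = merge zero (opsOfAdd w)
    opsOfAdd (keep w) = merge zero (shift (opsOf w))

  mutual
    runOps-opsOf : ∀ {r r′} (w : Word r r′) v → runOps (opsOf w) v ≗ reduce w v
    runOps-opsOf (skip w) v k       = runOps-opsOf w (VF.tail v) k
    runOps-opsOf (add w)  v k       = runOps-opsOfAdd w v k
    runOps-opsOf (keep w) v zero    = runOps-shift (opsOf w) v zero
    runOps-opsOf (keep w) v (suc k) = trans (runOps-shift (opsOf w) v (suc k)) (runOps-opsOf w (VF.tail v) k)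

    runOps-opsOfAdd : ∀ {r r′} (w : Word r r′) v → runOps (opsOfAdd w) v ≗ reduce (add w) v
    runOps-opsOfAdd (skip w) v k       = runOps-opsOfAdd w (VF.removeAt v (suc zero)) k
    runOps-opsOfAdd (add w)  v k       = begin
      runOps (opsOfAdd w) (sumAt zero v) k
        ≡⟨ runOps-opsOfAdd w (sumAt zero v) k ⟩
      e₀ (v zero + v (suc zero)) k + reduce w (VF.tail (VF.tail v)) k
        ≡⟨ cong (_+ reduce w (VF.tail (VF.tail v)) k) (e₀-+ _ _ k) ⟩
      (e₀ (v zero) k + e₀ (v (suc zero)) k) + reduce w _ k
        ≡⟨ ≈⇒≡ (+-assoc _ _ _) ⟩
      e₀ (v zero) k + (e₀ (v (suc zero)) k + reduce w _ k) ∎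
      where open ≡-Reasoning
    runOps-opsOfAdd (keep w) v zero    = runOps-shift (opsOf w) (sumAt zero v) zero
    runOps-opsOfAdd (keep w) v (suc k) = begin
      runOps (shift (opsOf w)) (sumAt zero v) (suc k) ≡⟨ runOps-shift (opsOf w) (sumAt zero v) (suc k) ⟩
      runOps (opsOf w) (VF.tail (VF.tail v)) k        ≡⟨ runOps-opsOf w (VF.tail (VF.tail v)) k ⟩
      reduce w (VF.tail (VF.tail v)) k                ≡⟨ ≈⇒≡ (+-identityˡ _) ⟨
      0# + reduce w (VF.tail (VF.tail v)) k           ∎
      where open ≡-Reasoning

  rowOps : ∀ {r r′ c} → Ops r r′ → Matrix r c → Matrix r′ c
  rowOps done        M = M
  rowOps (del i o)   M = rowOps o (deleteRow i M)
  rowOps (merge i o) M = rowOps o (sumRows i M)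

  colOps : ∀ {r c c′} → Ops c c′ → Matrix r c → Matrix r c′
  colOps done        M = M
  colOps (del j o)   M = colOps o (deleteCol j M)
  colOps (merge j o) M = colOps o (sumCols j M)

  parityMinor-colOps : ∀ {r c c′} (o : Ops c c′) (M : Matrix r c) → ParityMinor (colOps o M) M
  parityMinor-colOps done        M = done
  parityMinor-colOps (del j o)   M = delC j (parityMinor-colOps o (deleteCol j M))
  parityMinor-colOps (merge j o) M = sumC j (parityMinor-colOps o (sumCols j M))

  parityMinor-rowOps : ∀ {r r′ c r″ c″} (o : Ops r r′) (M : Matrix r c) {N : Matrix r″ c″} →
                       ParityMinor N (rowOps o M) → ParityMinor N M
  parityMinor-rowOps done        M pm = pm
  parityMinor-rowOps (del i o)   M pm = delR i (parityMinor-rowOps o (deleteRow i M) pm)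
  parityMinor-rowOps (merge i o) M pm = sumR i (parityMinor-rowOps o (sumRows i M) pm)

  sumRows-sumAt : ∀ {r c} (i : Fin r) (M : Matrix (suc r) c) k j → sumRows i M k j ≡ sumAt i (λ z → M z j) k
  sumRows-sumAt i M k j with k Fin.≟ i
  ... | yes _ = refl
  ... | no  _ = refl

  sumCols-sumAt : ∀ {r c} (j : Fin c) (M : Matrix r (suc c)) k l → sumCols j M k l ≡ sumAt j (M k) l
  sumCols-sumAt j M k l with l Fin.≟ j
  ... | yes _ = refl
  ... | no  _ = refl

  rowOps-runOps : ∀ {r r′ c} (o : Ops r r′) (M : Matrix r c) k l → rowOps o M k l ≡ runOps o (λ z → M z l) k
  rowOps-runOps done      M k l = refl
  rowOps-runOps (del i o) M k l = rowOps-runOps o (deleteRow i M) k l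
  rowOps-runOps (merge i o) M k l =
    trans (rowOps-runOps o (sumRows i M) k l) (runOps-cong o (λ z → sumRows-sumAt i M z l) k)

  colOps-runOps : ∀ {r c c′} (o : Ops c c′) (M : Matrix r c) k l → colOps o M k l ≡ runOps o (M k) l
  colOps-runOps done      M k l = refl
  colOps-runOps (del j o) M k l = colOps-runOps o (deleteCol j M) k l
  colOps-runOps (merge j o) M k l =
    trans (colOps-runOps o (sumCols j M) k l) (runOps-cong o (sumCols-sumAt j M k) l)

  reduceMatrix : ∀ {r r′ c c′} → Word r r′ → Word c c′ → Matrix r c → Matrix r′ c′
  reduceMatrix wR wC M k = reduce wC (λ l → reduce wR (λ z → M z l) k)

  reduceMatrix-parityMinor : ∀ {r r′ c c′} (wR : Word r r′) (wC : Word c c′) (M : Matrix r c) →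
    Σ (Matrix r′ c′) λ N → ParityMinor N M × (∀ k l → N k l ≡ reduceMatrix wR wC M k l)
  reduceMatrix-parityMinor wR wC M =
    colOps (opsOf wC) (rowOps (opsOf wR) M) ,
    parityMinor-rowOps (opsOf wR) M (parityMinor-colOps (opsOf wC) _) ,
    λ k l → begin
      colOps (opsOf wC) (rowOps (opsOf wR) M) k l
        ≡⟨ colOps-runOps (opsOf wC) _ k l ⟩
      runOps (opsOf wC) (rowOps (opsOf wR) M k) l
        ≡⟨ runOps-cong (opsOf wC) (rowOps-runOps (opsOf wR) M k) l ⟩
      runOps (opsOf wC) (λ l′ → runOps (opsOf wR) (λ z → M z l′) k) l
        ≡⟨ runOps-opsOf wC _ l ⟩
      reduce wC (λ l′ → runOps (opsOf wR) (λ z → M z l′) k) l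
        ≡⟨ reduce-cong wC (λ l′ → runOps-opsOf wR (λ z → M z l′) k) l ⟩
      reduceMatrix wR wC M k l ∎
    where open ≡-Reasoning

  sumAt-reduce : ∀ {r r′ c} (w : Word r r′) (j : Fin c) (M : Matrix r (suc c)) k →
                 sumAt j (λ l → reduce w (λ z → M z l) k) ≗ (λ l → reduce w (λ z → sumAt j (M z) l) k)
  sumAt-reduce w j M k l with l Fin.≟ j
  ... | yes _ = sym (reduce-+ w _ _ k)
  ... | no  _ = refl

  parityMinor⇒words : ∀ {r′ c′ r c} {N : Matrix r′ c′} {M : Matrix r c} → ParityMinor N M →
    Σ (Word r r′) λ wR → Σ (Word c c′) λ wC → ∀ k l → N k l ≡ reduceMatrix wR wC M k l
  parityMinor⇒words {M = M} done =
    keepAll _ , keepAll _ , λ k l → sym (trans (reduce-keepAll _ _ l) (reduce-keepAll _ (λ z → M z l) k))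
  parityMinor⇒words (delR i pm) with parityMinor⇒words pm
  ... | wR , wC , N≡ = insertSkip i wR , wC , λ k l →
    trans (N≡ k l) (reduce-cong wC (λ l′ → sym (reduce-insertSkip i wR _ k)) l)
  parityMinor⇒words {M = M} (sumR i pm) with parityMinor⇒words pm
  ... | wR , wC , N≡ = unmerge i wR , wC , λ k l →
    trans (N≡ k l) (reduce-cong wC (λ l′ →
      trans (reduce-cong wR (λ z → sumRows-sumAt i M z l′) k) (sym (reduce-unmerge i wR _ k))) l)
  parityMinor⇒words (delC j pm) with parityMinor⇒words pm
  ... | wR , wC , N≡ = wR , insertSkip j wC , λ k l →
    trans (N≡ k l) (sym (reduce-insertSkip j wC _ l))
  parityMinor⇒words {M = M} (sumC j pm) with parityMinor⇒words pm
  ... | wR , wC , N≡ = wR , unmerge j wC , λ k l → begin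
    _ ≡⟨ N≡ k l ⟩
    reduce wC (λ l′ → reduce wR (λ z → sumCols j M z l′) k) l
      ≡⟨ reduce-cong wC (λ l′ → reduce-cong wR (λ z → sumCols-sumAt j M z l′) k) l ⟩
    reduce wC (λ l′ → reduce wR (λ z → sumAt j (M z) l′) k) l
      ≡⟨ reduce-cong wC (sumAt-reduce wR j M k) l ⟨
    reduce wC (sumAt j (λ l′ → reduce wR (λ z → M z l′) k)) l
      ≡⟨ reduce-unmerge j wC _ l ⟨
    reduceMatrix wR (unmerge j wC) M k l ∎
    where open ≡-Reasoning

  entry-cong : ∀ {a b} {N N′ : Matrix a b} → (∀ i j → N i j ≡ N′ i j) →
               ∀ d x y → entry N′ d x y ≡ entry N d x y
  entry-cong {a} N≡N′ d x y with splitAt a x | splitAt a y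
  ... | inj₁ i | inj₁ j = refl
  ... | inj₁ i | inj₂ j = cong (λ e → does (e ≟F d)) (sym (N≡N′ i j))
  ... | inj₂ i | inj₁ j = refl
  ... | inj₂ i | inj₂ j = refl

  encode-≗ : ∀ {a b} (N N′ : Matrix a b) → (∀ i j → N i j ≡ N′ i j) → encode N ≅ encode N′
  encode-≗ N N′ N≡N′ = record { bij = ↔-id _ ; preserve = preserve }
    where
    preserve : ∀ s xs → rel (encode N′) s (Vec.map (λ x → x) xs) ≡ rel (encode N) s xs
    preserve rowSym       (x ∷ [])     = refl
    preserve ltSym        (x ∷ y ∷ []) = refl
    preserve (entSym d _) (x ∷ y ∷ []) = entry-cong N≡N′ d x y

  encode-cast : ∀ {a b a′ b′} (N : Matrix a b) (N′ : Matrix a′ b′) (ea : a ≡ a′) (eb : b ≡ b′) →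
                (∀ i j → N i j ≡ N′ (Fin.cast ea i) (Fin.cast eb j)) → encode N ≅ encode N′
  encode-cast N N′ refl refl N≡N′ =
    encode-≗ N N′ (λ i j → trans (N≡N′ i j) (cong₂ N′ (FinP.cast-is-id refl i) (FinP.cast-is-id refl j)))

  sumOver : ∀ {n} → (Fin n → Bool) → (Fin n → Carrier) → Carrier
  sumOver p v = sum (λ z → if p z then v z else 0#)

  sum-zero : ∀ n → sum {n} (λ _ → 0#) ≡ 0#
  sum-zero n = ≈⇒≡ (sum-replicate-zero n)

  sum-↑ : ∀ m n (f : Fin (m ℕ.+ n) → Carrier) → sum f ≡ sum (f ∘ (_↑ˡ n)) + sum (f ∘ (m ↑ʳ_))
  sum-↑ zero    n f = sym (≈⇒≡ (+-identityˡ _))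
  sum-↑ (suc m) n f = trans (cong (f zero +_) (sum-↑ m n (f ∘ suc))) (sym (≈⇒≡ (+-assoc _ _ _)))

  sumOver-cong : ∀ {n} {p q : Fin n → Bool} {f g : Fin n → Carrier} → p ≗ q → f ≗ g → sumOver p f ≡ sumOver q g
  sumOver-cong p≗q f≗g = sum-cong-≗ (λ z → cong₂ (λ b x → if b then x else 0#) (p≗q z) (f≗g z))

  sumOver-↑ˡ : ∀ m n (p : Fin (m ℕ.+ n) → Bool) f → (∀ z → p (m ↑ʳ z) ≡ false) →
               sumOver p f ≡ sumOver (p ∘ (_↑ˡ n)) (f ∘ (_↑ˡ n))
  sumOver-↑ˡ m n p f p≡false =
    trans (sum-↑ m n (λ z → if p z then f z else 0#))
          (trans (cong (sumOver (p ∘ (_↑ˡ n)) (f ∘ (_↑ˡ n)) +_) right≡0) (≈⇒≡ (+-identityʳ _)))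
    where
    right≡0 : sum (λ z → if p (m ↑ʳ z) then f (m ↑ʳ z) else 0#) ≡ 0#
    right≡0 = trans (sum-cong-≗ (λ z → cong (λ b → if b then f (m ↑ʳ z) else 0#) (p≡false z))) (sum-zero n)

  sumOver-↑ʳ : ∀ m n (p : Fin (m ℕ.+ n) → Bool) f → (∀ z → p (z ↑ˡ n) ≡ false) →
               sumOver p f ≡ sumOver (p ∘ (m ↑ʳ_)) (f ∘ (m ↑ʳ_))
  sumOver-↑ʳ m n p f p≡false =
    trans (sum-↑ m n (λ z → if p z then f z else 0#))
          (trans (cong (_+ sumOver (p ∘ (m ↑ʳ_)) (f ∘ (m ↑ʳ_))) left≡0) (≈⇒≡ (+-identityˡ _)))
    where
    left≡0 : sum (λ z → if p (z ↑ˡ n) then f (z ↑ˡ n) else 0#) ≡ 0#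
    left≡0 = trans (sum-cong-≗ (λ z → cong (λ b → if b then f (z ↑ˡ n) else 0#) (p≡false z))) (sum-zero m)

  wordOf : ∀ {n} (kept added : Fin n → Bool) → Word n (count kept)
  wordOf {zero}  kept added = []
  wordOf {suc n} kept added with kept zero | added zero
  ... | true  | _     = keep (wordOf (kept ∘ suc) (added ∘ suc))
  ... | false | true  = add  (wordOf (kept ∘ suc) (added ∘ suc))
  ... | false | false = skip (wordOf (kept ∘ suc) (added ∘ suc))

  e₀-toℕ : ∀ {n} a (k : Fin n) → e₀ a k ≡ (if toℕ k ≡ᵇ 0 then a else 0#)
  e₀-toℕ a zero    = refl
  e₀-toℕ a (suc k) = refl

  reduce-wordOf : ∀ {n} (kept added : Fin n → Bool) v k →
                  reduce (wordOf kept added) v k ≡ sumOver (inBlock kept added (select kept k)) v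
  reduce-wordOf {suc n} kept added v k with kept zero | added zero
  reduce-wordOf {suc n} kept added v zero | true | _ =
    sym (trans (cong (v zero +_) (sum-zero n)) (≈⇒≡ (+-identityʳ (v zero))))
  reduce-wordOf {suc n} kept added v (suc k) | true | _ =
    trans (reduce-wordOf (kept ∘ suc) (added ∘ suc) (VF.tail v) k) (sym (≈⇒≡ (+-identityˡ _)))
  reduce-wordOf {suc n} kept added v k | false | true
    rewrite count-below-select (kept ∘ suc) k =
    cong₂ _+_ (e₀-toℕ (v zero) k) (reduce-wordOf (kept ∘ suc) (added ∘ suc) (VF.tail v) k)
  reduce-wordOf {suc n} kept added v k | false | false =
    trans (reduce-wordOf (kept ∘ suc) (added ∘ suc) (VF.tail v) k) (sym (≈⇒≡ (+-identityˡ _)))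

  keptOf : ∀ {n n′} → Word n n′ → Fin n → Bool
  keptOf (skip w) zero    = false
  keptOf (add w)  zero    = false
  keptOf (keep w) zero    = true
  keptOf (skip w) (suc i) = keptOf w i
  keptOf (add w)  (suc i) = keptOf w i
  keptOf (keep w) (suc i) = keptOf w i

  addedOf : ∀ {n n′} → Word n n′ → Fin n → Bool
  addedOf (skip w) zero    = false
  addedOf (add w)  zero    = true
  addedOf (keep w) zero    = false
  addedOf (skip w) (suc i) = addedOf w i
  addedOf (add w)  (suc i) = addedOf w i
  addedOf (keep w) (suc i) = addedOf w i

  e₀-cast : ∀ {m n} (e : m ≡ n) a (k : Fin m) → e₀ a (Fin.cast e k) ≡ e₀ a k
  e₀-cast refl a zero    = refl
  e₀-cast refl a (suc k) = refl

  wordOf-colours : ∀ {n n′} (w : Word n n′) {kept added : Fin n → Bool} →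
                   kept ≗ keptOf w → added ≗ addedOf w →
                   Σ (count kept ≡ n′) λ e → ∀ v k → reduce (wordOf kept added) v k ≡ reduce w v (Fin.cast e k)
  wordOf-colours []       _      _       = refl , λ v ()
  wordOf-colours (skip w) {kept} {added} kept≗ added≗
    with kept zero | added zero | kept≗ zero | added≗ zero
  ... | _ | _ | refl | refl with wordOf-colours w (kept≗ ∘ suc) (added≗ ∘ suc)
  ...   | e , reduce≡ = e , λ v → reduce≡ (VF.tail v)
  wordOf-colours (add w)  {kept} {added} kept≗ added≗
    with kept zero | added zero | kept≗ zero | added≗ zero
  ... | _ | _ | refl | refl with wordOf-colours w (kept≗ ∘ suc) (added≗ ∘ suc)
  ...   | e , reduce≡ = e , λ v k → cong₂ _+_ (sym (e₀-cast e (v zero) k)) (reduce≡ (VF.tail v) k)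
  wordOf-colours (keep w) {kept} {added} kept≗ added≗
    with kept zero | kept≗ zero
  ... | _ | refl with wordOf-colours w (kept≗ ∘ suc) (added≗ ∘ suc)
  ...   | e , reduce≡ = cong suc e , λ { v zero → refl ; v (suc k) → reduce≡ (VF.tail v) k }

  -- two of the multiples 0 · 1#, …, |elements| · 1# have the same index in elements
  characteristic : ∃[ m ] (suc m · 1# ≡ 0#)
  characteristic
    with FinP.pigeonhole (ℕP.n<1+n (length elements)) (λ k → Any.index (complete (toℕ k · 1#)))
  ... | i , j , i<j , sameIndex with ℕP.m≤n⇒∃[o]m+o≡n i<j
  ... | o , 1+i+o≡j = o , ≈⇒≡ (+-G.identityˡ-unique (suc o · 1#) (toℕ i · 1#) (reflexive (begin
    suc o · 1# + toℕ i · 1#  ≡⟨ ≈⇒≡ (×-homo-+ 1# (suc o) (toℕ i)) ⟨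
    (suc o ℕ.+ toℕ i) · 1#   ≡⟨ cong (_· 1#) (trans (ℕP.+-comm (suc o) (toℕ i))
                                                    (trans (ℕP.+-suc (toℕ i) o) 1+i+o≡j)) ⟩
    toℕ j · 1#               ≡⟨ lookup-index (complete (toℕ j · 1#)) ⟩
    List.lookup elements _   ≡⟨ cong (List.lookup elements) sameIndex ⟨
    List.lookup elements _   ≡⟨ lookup-index (complete (toℕ i · 1#)) ⟨
    toℕ i · 1#               ∎)))
    where open ≡-Reasoning

  χ : ℕ
  χ = suc (proj₁ characteristic)

  χ·≡0 : ∀ x → χ · x ≡ 0#
  χ·≡0 x = begin
    χ · x          ≡⟨ cong (χ ·_) (≈⇒≡ (*-identityˡ x)) ⟨
    χ · (1# * x)   ≡⟨ ≈⇒≡ (×-assoc-* χ 1# x) ⟨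
    (χ · 1#) * x   ≡⟨ cong (_* x) (proj₂ characteristic) ⟩
    0# * x         ≡⟨ ≈⇒≡ (zeroˡ x) ⟩
    0#             ∎
    where open ≡-Reasoning

  ·-mod-χ : ∀ n x → n · x ≡ (n % χ) · x
  ·-mod-χ n x = begin
    n · x                                  ≡⟨ cong (_· x) (m≡m%n+[m/n]*n n χ) ⟩
    (n % χ ℕ.+ n / χ ℕ.* χ) · x            ≡⟨ ≈⇒≡ (×-homo-+ x (n % χ) (n / χ ℕ.* χ)) ⟩
    (n % χ) · x + (n / χ ℕ.* χ) · x        ≡⟨ cong (λ m → (n % χ) · x + m · x) (ℕP.*-comm (n / χ) χ) ⟩
    (n % χ) · x + (χ ℕ.* (n / χ)) · x      ≡⟨ cong ((n % χ) · x +_) (≈⇒≡ (×-assocˡ x χ (n / χ))) ⟨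
    (n % χ) · x + χ · ((n / χ) · x)        ≡⟨ cong ((n % χ) · x +_) (χ·≡0 _) ⟩
    (n % χ) · x + 0#                       ≡⟨ ≈⇒≡ (+-identityʳ _) ⟩
    (n % χ) · x                            ∎
    where open ≡-Reasoning

  distinctElements : List Carrier
  distinctElements = deduplicate _≟F_ elements

  ∑ₗ : List Carrier → (Carrier → Carrier) → Carrier
  ∑ₗ xs f = List.foldr (λ d s → f d + s) 0# xs

  ∑ₗ-cong : ∀ xs {f g : Carrier → Carrier} → f ≗ g → ∑ₗ xs f ≡ ∑ₗ xs g
  ∑ₗ-cong []       f≗g = refl
  ∑ₗ-cong (d ∷ xs) f≗g = cong₂ _+_ (f≗g d) (∑ₗ-cong xs f≗g)

  ∑ₗ-+ : ∀ xs (f g : Carrier → Carrier) → ∑ₗ xs (λ d → f d + g d) ≡ ∑ₗ xs f + ∑ₗ xs g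
  ∑ₗ-+ []       f g = sym (≈⇒≡ (+-identityˡ 0#))
  ∑ₗ-+ (d ∷ xs) f g = trans (cong (f d + g d +_) (∑ₗ-+ xs f g)) (+-interchange _ _ _ _)

  ∑ₗ-zero : ∀ xs (f : Carrier → Carrier) → (∀ d → d ∈ xs → f d ≡ 0#) → ∑ₗ xs f ≡ 0#
  ∑ₗ-zero []       f f≡0 = refl
  ∑ₗ-zero (d ∷ xs) f f≡0 =
    trans (cong₂ _+_ (f≡0 d (here refl)) (∑ₗ-zero xs f (λ d′ → f≡0 d′ ∘ there))) (≈⇒≡ (+-identityˡ 0#))

  ∑ₗ-indicator : ∀ {xs} → Unique xs → ∀ {x} → x ∈ xs → ∑ₗ xs (λ d → indicator (does (x ≟F d)) · d) ≡ x
  ∑ₗ-indicator {d ∷ xs} (d∉xs ∷ unique) {x} (here refl) rewrite dec-true (x ≟F x) refl = begin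
    (x + 0#) + ∑ₗ xs _  ≡⟨ cong ((x + 0#) +_) (∑ₗ-zero xs _ (λ d′ d′∈xs → cong (λ b → indicator b · d′)
                                                  (dec-false (x ≟F d′) (All.lookup d∉xs d′∈xs)))) ⟩
    (x + 0#) + 0#       ≡⟨ ≈⇒≡ (+-identityʳ _) ⟩
    x + 0#              ≡⟨ ≈⇒≡ (+-identityʳ x) ⟩
    x                   ∎
    where open ≡-Reasoning
  ∑ₗ-indicator {d ∷ xs} (d∉xs ∷ unique) {x} (there x∈xs)
    rewrite dec-false (x ≟F d) (λ x≡d → All.lookup d∉xs x∈xs (sym x≡d)) =
    trans (≈⇒≡ (+-identityˡ _)) (∑ₗ-indicator unique x∈xs)

  occurrences : ∀ {m} → (Fin m → Carrier) → Carrier → ℕ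
  occurrences g d = count (λ z → does (g z ≟F d))

  sum-by-values : ∀ {m} (g : Fin m → Carrier) → sum g ≡ ∑ₗ distinctElements (λ d → occurrences g d · d)
  sum-by-values {zero}  g = sym (∑ₗ-zero distinctElements _ (λ _ _ → refl))
  sum-by-values {suc m} g = begin
    g zero + sum (g ∘ suc)
      ≡⟨ cong₂ _+_ (∑ₗ-indicator (deduplicate-! _≟F_ elements) (∈-deduplicate⁺ _≟F_ (complete (g zero))))
                   (sym (sum-by-values (g ∘ suc))) ⟨
    ∑ₗ D (λ d → indicator (does (g zero ≟F d)) · d) + ∑ₗ D (λ d → occurrences (g ∘ suc) d · d)
      ≡⟨ ∑ₗ-+ D _ _ ⟨
    ∑ₗ D (λ d → indicator (does (g zero ≟F d)) · d + occurrences (g ∘ suc) d · d)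
      ≡⟨ ∑ₗ-cong D (λ d → ≈⇒≡ (×-homo-+ d (indicator (does (g zero ≟F d))) _)) ⟨
    ∑ₗ D (λ d → occurrences g d · d) ∎
    where
    open ≡-Reasoning
    D = distinctElements

  ·-zeroʳ : ∀ n → n · 0# ≡ 0#
  ·-zeroʳ zero    = refl
  ·-zeroʳ (suc n) = trans (≈⇒≡ (+-identityˡ _)) (·-zeroʳ n)

  ∑ₗ-·-cong : ∀ xs (f g : Carrier → ℕ) → (∀ d → d ≢ 0# → f d ≡ g d) →
              ∑ₗ xs (λ d → f d · d) ≡ ∑ₗ xs (λ d → g d · d)
  ∑ₗ-·-cong xs f g f≡g = ∑ₗ-cong xs same
    where
    same : ∀ d → f d · d ≡ g d · d
    same d with d ≟F 0#
    ... | yes refl = trans (·-zeroʳ (f 0#)) (sym (·-zeroʳ (g 0#)))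
    ... | no  d≢0  = cong (_· d) (f≡g d d≢0)

  ≟-if : ∀ (b : Bool) x {d} → d ≢ 0# → does ((if b then x else 0#) ≟F d) ≡ b ∧ does (x ≟F d)
  ≟-if true  x d≢0 = refl
  ≟-if false x d≢0 = dec-false (0# ≟F _) (d≢0 ∘ sym)

  sumOver-by-values : ∀ {m} (p : Fin m → Bool) (g : Fin m → Carrier) (#g : Carrier → ℕ) →
                      (∀ d → d ≢ 0# → count (λ z → p z ∧ does (g z ≟F d)) ≡ #g d) →
                      sumOver p g ≡ ∑ₗ distinctElements (λ d → #g d · d)
  sumOver-by-values p g #g #g≡ = trans (sum-by-values (λ z → if p z then g z else 0#))
    (∑ₗ-·-cong distinctElements _ #g (λ d d≢0 → trans (count-cong (λ z → ≟-if (p z) (g z) d≢0)) (#g≡ d d≢0)))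

  ≟-translate : ∀ a s t → does (s ≟F (- a + t)) ≡ does ((a + s) ≟F t)
  ≟-translate a s t = does-⇔ (mk⇔ to from) (s ≟F (- a + t)) ((a + s) ≟F t)
    where
    to : s ≡ - a + t → a + s ≡ t
    to refl = ≈⇒≡ (+-G.\\-leftDividesˡ a t)
    from : a + s ≡ t → s ≡ - a + t
    from a+s≡t = ≈⇒≡ (+-G.y≈x\\z a s t (reflexive a+s≡t))

  witnesses : ∀ {Σ' n} (A : Structure Σ') → (Fin n → Fin (size A)) → Formula Σ' (suc n) → ℕ
  witnesses A env φ = count (λ v → ⟦ φ ⟧ A (v VF.∷ env))

  -- only the numbers of witnesses modulo χ matter, and those FO+MOD can express
  sumIs : ∀ {Σ' n} → List Carrier → (Carrier → Formula Σ' (suc n)) → Carrier → Formula Σ' n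
  sumIs []       φ t = if does (0# ≟F t) then ⊤ᶠ else ⊥ᶠ
  sumIs (d ∷ xs) φ t = ⋁< χ (λ k → conj (existsMod k χ (φ d)) (sumIs xs φ (- (k · d) + t)))

  sumIs-sem : ∀ {Σ' n} (A : Structure Σ') (env : Fin n → Fin (size A)) xs φ t →
              ⟦ sumIs xs φ t ⟧ A env ≡ does (∑ₗ xs (λ d → witnesses A env (φ d) · d) ≟F t)
  sumIs-sem A env [] φ t with 0# ≟F t
  ... | yes _ = ⊤ᶠ-sem A env
  ... | no  _ = ⊥ᶠ-sem A env
  sumIs-sem A env (d ∷ xs) φ t = begin
    ⟦ sumIs (d ∷ xs) φ t ⟧ A env
      ≡⟨ ⋁<-single A env χ _ (#φ % χ) (m%n<n #φ χ) wrongResidue ⟩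
    ((#φ % χ) ≡ᵇ (#φ % χ % χ)) ∧ ⟦ sumIs xs φ (- ((#φ % χ) · d) + t) ⟧ A env
      ≡⟨ cong (λ m → ((#φ % χ) ≡ᵇ m) ∧ ⟦ sumIs xs φ (- ((#φ % χ) · d) + t) ⟧ A env) (m%n%n≡m%n #φ χ) ⟩
    ((#φ % χ) ≡ᵇ (#φ % χ)) ∧ ⟦ sumIs xs φ (- ((#φ % χ) · d) + t) ⟧ A env
      ≡⟨ cong (_∧ ⟦ sumIs xs φ (- ((#φ % χ) · d) + t) ⟧ A env) (dec-true ((#φ % χ) ℕ.≟ (#φ % χ)) refl) ⟩
    ⟦ sumIs xs φ (- ((#φ % χ) · d) + t) ⟧ A env
      ≡⟨ sumIs-sem A env xs φ _ ⟩
    does (rest ≟F (- ((#φ % χ) · d) + t))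
      ≡⟨ ≟-translate _ rest t ⟩
    does (((#φ % χ) · d + rest) ≟F t)
      ≡⟨ cong (λ a → does ((a + rest) ≟F t)) (·-mod-χ #φ d) ⟨
    does ((#φ · d + rest) ≟F t) ∎
    where
    open ≡-Reasoning
    #φ = witnesses A env (φ d)
    rest = ∑ₗ xs (λ d′ → witnesses A env (φ d′) · d′)
    wrongResidue : ∀ k → k ℕ.< χ → k ≢ #φ % χ →
                   ⟦ conj (existsMod k χ (φ d)) (sumIs xs φ (- (k · d) + t)) ⟧ A env ≡ false
    wrongResidue k k<χ k≢ rewrite m<n⇒m%n≡m k<χ | dec-false ((#φ % χ) ℕ.≟ k) (k≢ ∘ sym) = refl

  Σ⁺ : Signature
  Σ⁺ = MSig +U 2

  rowᶠ : ∀ {n} → Fin n → Formula Σ⁺ n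
  rowᶠ x = atom (inj₁ rowSym) (x ∷ [])

  lessᶠ : ∀ {n} → Fin n → Fin n → Formula Σ⁺ n
  lessᶠ x y = atom (inj₁ ltSym) (x ∷ y ∷ [])

  keptᶠ addedᶠ : ∀ {n} → Fin n → Formula Σ⁺ n
  keptᶠ  x = atom (inj₂ zero) (x ∷ [])
  addedᶠ x = atom (inj₂ (suc zero)) (x ∷ [])

  nonzero : ∀ {d} → d ≢ 0# → T (not (does (d ≟F 0#)))
  nonzero {d} d≢0 rewrite dec-false (d ≟F 0#) d≢0 = _

  -- there is no symbol E_0; a value 0 never contributes to a sum
  hasValueᶠ : ∀ {n} → Carrier → Fin n → Fin n → Formula Σ⁺ n
  hasValueᶠ d z w with d ≟F 0#
  ... | yes _   = ⊥ᶠ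
  ... | no d≢0 = atom (inj₁ (entSym d (nonzero d≢0))) (z ∷ w ∷ [])

  sameSortᶠ : ∀ {n} → Fin n → Fin n → Formula Σ⁺ n
  sameSortᶠ z x = disj (conj (rowᶠ z) (rowᶠ x)) (conj (neg (rowᶠ z)) (neg (rowᶠ x)))

  inBlockᶠ : ∀ {n} → Fin n → Fin n → Formula Σ⁺ n
  inBlockᶠ x z = conj (sameSortᶠ z x) (disj (equal z x)
    (conj (lessᶠ z x) (conj (neg (keptᶠ z)) (conj (addedᶠ z)
      (neg (exists (conj (lessᶠ (suc z) zero) (conj (lessᶠ zero (suc x)) (keptᶠ zero)))))))))

  columnSumIsᶠ : ∀ {n} → Carrier → Fin n → Fin n → Formula Σ⁺ n
  columnSumIsᶠ b x w = sumIs distinctElements (λ d → conj (inBlockᶠ (suc x) zero) (hasValueᶠ d zero (suc w))) b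

  entryᶠ : ∀ {n} → Carrier → Fin n → Fin n → Formula Σ⁺ n
  entryᶠ a x y = conj (rowᶠ x) (conj (neg (rowᶠ y))
    (sumIs distinctElements (λ b → conj (inBlockᶠ (suc y) zero) (columnSumIsᶠ b (suc x) zero)) a))

  -- colour 0 marks the kept rows and columns, colour 1 those added to the next kept one
  pmInterpretation : Interpretation Σ⁺ MSig
  pmInterpretation = record
    { ν = keptᶠ zero
    ; ρ = λ { rowSym → rowᶠ zero ; ltSym → lessᶠ zero (suc zero) ; (entSym a _) → entryᶠ a zero (suc zero) } }

  pmTransduction : Transduction MSig MSig
  pmTransduction = record { k = 2 ; interp = pmInterpretation }

  Colouring : ℕ → Set
  Colouring n = Fin 2 → Fin n → Bool

  module _ {r c : ℕ} where

    sameSort : Fin (r ℕ.+ c) → Fin (r ℕ.+ c) → Bool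
    sameSort z x = (isRow {r} {c} z ∧ isRow {r} {c} x) ∨ (not (isRow {r} {c} z) ∧ not (isRow {r} {c} x))

    block : Colouring (r ℕ.+ c) → Fin (r ℕ.+ c) → Fin (r ℕ.+ c) → Bool
    block col x z = sameSort z x ∧ inBlock (col zero) (col (suc zero)) x z

    value : Matrix r c → Fin (r ℕ.+ c) → Fin (r ℕ.+ c) → Carrier
    value M z w with splitAt r z | splitAt r w
    ... | inj₁ i | inj₂ j = M i j
    ... | _      | _      = 0#

    blockEntry : Colouring (r ℕ.+ c) → Matrix r c → Fin (r ℕ.+ c) → Fin (r ℕ.+ c) → Carrier
    blockEntry col M x y = sumOver (block col y) (λ w → sumOver (block col x) (λ z → value M z w))

    value-entry : ∀ (M : Matrix r c) z w {d} → d ≢ 0# → does (value M z w ≟F d) ≡ entry M d z w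
    value-entry M z w d≢0 with splitAt r z | splitAt r w
    ... | inj₁ _ | inj₂ _ = refl
    ... | inj₁ _ | inj₁ _ = dec-false (0# ≟F _) (d≢0 ∘ sym)
    ... | inj₂ _ | inj₁ _ = dec-false (0# ≟F _) (d≢0 ∘ sym)
    ... | inj₂ _ | inj₂ _ = dec-false (0# ≟F _) (d≢0 ∘ sym)

    module _ (M : Matrix r c) (col : Colouring (r ℕ.+ c)) where

      A⁺ : Structure Σ⁺
      A⁺ = expand (encode M) 2 col

      inBlockᶠ-sem : ∀ {n} (env : Fin n → Fin (r ℕ.+ c)) x z → ⟦ inBlockᶠ x z ⟧ A⁺ env ≡ block col (env x) (env z)
      inBlockᶠ-sem env x z =
        cong (λ b → sameSort (env z) (env x) ∧ (does (env z Fin.≟ env x) ∨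
                      (does (env z <? env x) ∧ not (col zero (env z)) ∧ col (suc zero) (env z) ∧ b)))
             (not-involutive (noKeptBetween (col zero) (env z) (env x)))

      hasValueᶠ-sem : ∀ {n} (env : Fin n → Fin (r ℕ.+ c)) {d} z w → d ≢ 0# →
                      ⟦ hasValueᶠ d z w ⟧ A⁺ env ≡ entry M d (env z) (env w)
      hasValueᶠ-sem env {d} z w d≢0 with d ≟F 0#
      ... | yes d≡0 = contradiction d≡0 d≢0
      ... | no  _   = refl

      columnSumIsᶠ-sem : ∀ {n} (env : Fin n → Fin (r ℕ.+ c)) b x w →
        ⟦ columnSumIsᶠ b x w ⟧ A⁺ env ≡ does (sumOver (block col (env x)) (λ z → value M z (env w)) ≟F b)
      columnSumIsᶠ-sem env b x w = trans (sumIs-sem A⁺ env distinctElements _ b)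
        (cong (λ s → does (s ≟F b)) (sym (sumOver-by-values (block col (env x)) (λ z → value M z (env w)) _ counts)))
        where
        counts : ∀ d → d ≢ 0# → count (λ z → block col (env x) z ∧ does (value M z (env w) ≟F d))
                              ≡ witnesses A⁺ env (conj (inBlockᶠ (suc x) zero) (hasValueᶠ d zero (suc w)))
        counts d d≢0 = count-cong λ z → cong₂ _∧_
          (sym (inBlockᶠ-sem (z VF.∷ env) (suc x) zero))
          (trans (value-entry M z (env w) d≢0) (sym (hasValueᶠ-sem (z VF.∷ env) zero (suc w) d≢0)))

      entryᶠ-sem : ∀ {n} (env : Fin n → Fin (r ℕ.+ c)) a x y →
        ⟦ entryᶠ a x y ⟧ A⁺ env ≡
          isRow {r} {c} (env x) ∧ not (isRow {r} {c} (env y)) ∧ does (blockEntry col M (env x) (env y) ≟F a)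
      entryᶠ-sem env a x y = cong (λ b → isRow {r} {c} (env x) ∧ not (isRow {r} {c} (env y)) ∧ b)
        (trans (sumIs-sem A⁺ env distinctElements _ a)
               (cong (λ s → does (s ≟F a)) (sym (sumOver-by-values (block col (env y)) columnSum _ counts))))
        where
        columnSum : Fin (r ℕ.+ c) → Carrier
        columnSum w = sumOver (block col (env x)) (λ z → value M z w)
        counts : ∀ b → b ≢ 0# → count (λ w → block col (env y) w ∧ does (columnSum w ≟F b))
                              ≡ witnesses A⁺ env (conj (inBlockᶠ (suc y) zero) (columnSumIsᶠ b (suc x) zero))
        counts b b≢0 = count-cong λ w → sym (cong₂ _∧_
          (inBlockᶠ-sem (w VF.∷ env) (suc y) zero) (columnSumIsᶠ-sem (w VF.∷ env) b (suc x) zero))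


    isRow-↑ˡ : ∀ (i : Fin r) → isRow {r} {c} (i ↑ˡ c) ≡ true
    isRow-↑ˡ i rewrite FinP.splitAt-↑ˡ r i c = refl

    isRow-↑ʳ : ∀ (j : Fin c) → isRow {r} {c} (r ↑ʳ j) ≡ false
    isRow-↑ʳ j rewrite FinP.splitAt-↑ʳ r c j = refl

    value-↑ : ∀ (M : Matrix r c) i j → value M (i ↑ˡ c) (r ↑ʳ j) ≡ M i j
    value-↑ M i j rewrite FinP.splitAt-↑ˡ r i c | FinP.splitAt-↑ʳ r c j = refl

    module _ (col : Colouring (r ℕ.+ c)) where

      rowKept rowAdded : Fin r → Bool
      rowKept  = col zero ∘ (_↑ˡ c)
      rowAdded = col (suc zero) ∘ (_↑ˡ c)

      colKept colAdded : Fin c → Bool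
      colKept  = col zero ∘ (r ↑ʳ_)
      colAdded = col (suc zero) ∘ (r ↑ʳ_)

      block-↑ˡ : ∀ x z → block col (x ↑ˡ c) (z ↑ˡ c) ≡ inBlock rowKept rowAdded x z
      block-↑ˡ x z rewrite isRow-↑ˡ x | isRow-↑ˡ z = inBlock-↑ˡ c (col zero) (col (suc zero)) x z

      block-↑ʳ : ∀ x z → block col (r ↑ʳ x) (r ↑ʳ z) ≡ inBlock colKept colAdded x z
      block-↑ʳ x z rewrite isRow-↑ʳ x | isRow-↑ʳ z = inBlock-↑ʳ r (col zero) (col (suc zero)) x z

      block-↑ˡ↑ʳ : ∀ x z → block col (x ↑ˡ c) (r ↑ʳ z) ≡ false
      block-↑ˡ↑ʳ x z rewrite isRow-↑ˡ x | isRow-↑ʳ z = refl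

      block-↑ʳ↑ˡ : ∀ x z → block col (r ↑ʳ x) (z ↑ˡ c) ≡ false
      block-↑ʳ↑ˡ x z rewrite isRow-↑ʳ x | isRow-↑ˡ z = refl

      minorOf : Matrix r c → Matrix (count rowKept) (count colKept)
      minorOf = reduceMatrix (wordOf rowKept rowAdded) (wordOf colKept colAdded)

      blockEntry-minorOf : ∀ M i j → blockEntry col M (select rowKept i ↑ˡ c) (r ↑ʳ select colKept j) ≡ minorOf M i j
      blockEntry-minorOf M i j = begin
        blockEntry col M (x ↑ˡ c) (r ↑ʳ y)
          ≡⟨ sumOver-↑ʳ r c (block col (r ↑ʳ y)) _ (block-↑ʳ↑ˡ y) ⟩
        sumOver (block col (r ↑ʳ y) ∘ (r ↑ʳ_)) (λ w → sumOver (block col (x ↑ˡ c)) (λ z → value M z (r ↑ʳ w)))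
          ≡⟨ sumOver-cong (block-↑ʳ y)
                          (λ w → sumOver-↑ˡ r c (block col (x ↑ˡ c)) (λ z → value M z (r ↑ʳ w)) (block-↑ˡ↑ʳ x)) ⟩
        sumOver (inBlock colKept colAdded y)
                (λ w → sumOver (block col (x ↑ˡ c) ∘ (_↑ˡ c)) (λ z → value M (z ↑ˡ c) (r ↑ʳ w)))
          ≡⟨ sumOver-cong (λ _ → refl) (λ w → sumOver-cong (block-↑ˡ x) (λ z → value-↑ M z w)) ⟩
        sumOver (inBlock colKept colAdded y) (λ w → sumOver (inBlock rowKept rowAdded x) (λ z → M z w))
          ≡⟨ sumOver-cong (λ _ → refl) (λ w → reduce-wordOf rowKept rowAdded (λ z → M z w) i) ⟨
        sumOver (inBlock colKept colAdded y) (λ w → reduce (wordOf rowKept rowAdded) (λ z → M z w) i)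
          ≡⟨ reduce-wordOf colKept colAdded _ j ⟨
        minorOf M i j ∎
        where
        open ≡-Reasoning
        x = select rowKept i
        y = select colKept j

      module _ (M : Matrix r c) where

        domain : List (Fin (r ℕ.+ c))
        domain = interpDomain pmInterpretation (A⁺ M col)

        domain≡kept : length domain ≡ count (col zero)
        domain≡kept = length-filterᵇ-tabulate (r ℕ.+ c) (λ z → z) (col zero)

        domain≡minor : length domain ≡ count rowKept ℕ.+ count colKept
        domain≡minor = trans domain≡kept (count-↑ r c (col zero))

        toMinor : Fin (length domain) → Fin (count rowKept ℕ.+ count colKept)
        toMinor = Fin.cast domain≡minor

        embed : Fin (count rowKept ℕ.+ count colKept) → Fin (r ℕ.+ c)
        embed u = Fin.join r c (Sum.map (select rowKept) (select colKept) (splitAt (count rowKept) u))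

        lookup-domain : ∀ k → List.lookup domain k ≡ select (col zero) (Fin.cast domain≡kept k)
        lookup-domain = lookup-filterᵇ-tabulate (r ℕ.+ c) (λ z → z) (col zero)

        lookup-domain-embed : ∀ k → List.lookup domain k ≡ embed (toMinor k)
        lookup-domain-embed k = trans (lookup-domain k) (select-↑ r c (col zero) _ (toMinor k)
          (trans (FinP.toℕ-cast domain≡kept k) (sym (FinP.toℕ-cast domain≡minor k))))

        isRow-embed : ∀ u → isRow {r} {c} (embed u) ≡ isRow {count rowKept} {count colKept} u
        isRow-embed u with splitAt (count rowKept) u
        ... | inj₁ i = isRow-↑ˡ (select rowKept i)
        ... | inj₂ j = isRow-↑ʳ (select colKept j)

        entry-embed : ∀ a u u′ → entry (minorOf M) a u u′ ≡
          isRow {r} {c} (embed u) ∧ not (isRow {r} {c} (embed u′)) ∧ does (blockEntry col M (embed u) (embed u′) ≟F a)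
        entry-embed a u u′ with splitAt (count rowKept) u | splitAt (count rowKept) u′
        ... | inj₁ i | inj₁ j rewrite isRow-↑ˡ (select rowKept i) | isRow-↑ˡ (select rowKept j) = refl
        ... | inj₁ i | inj₂ j = sym (begin
          isRow {r} {c} x ∧ not (isRow {r} {c} y) ∧ does (blockEntry col M x y ≟F a)
            ≡⟨ cong₂ (λ b b′ → b ∧ not b′ ∧ does (blockEntry col M x y ≟F a)) (isRow-↑ˡ _) (isRow-↑ʳ _) ⟩
          does (blockEntry col M x y ≟F a)
            ≡⟨ cong (λ e → does (e ≟F a)) (blockEntry-minorOf M i j) ⟩
          does (minorOf M i j ≟F a) ∎)
          where
          open ≡-Reasoning
          x = select rowKept i ↑ˡ c
          y = r ↑ʳ select colKept j
        ... | inj₂ i | _      rewrite isRow-↑ʳ (select colKept i) = refl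

        interpretation≅minor : apply pmInterpretation (A⁺ M col) ≅ encode (minorOf M)
        interpretation≅minor = record
          { bij      = mk↔ₛ′ toMinor (Fin.cast (sym domain≡minor))
                             (FinP.cast-involutive domain≡minor (sym domain≡minor))
                             (FinP.cast-involutive (sym domain≡minor) domain≡minor)
          ; preserve = preserve }
          where
          preserve : ∀ s xs → rel (encode (minorOf M)) s (Vec.map toMinor xs) ≡ rel (apply pmInterpretation (A⁺ M col)) s xs
          preserve rowSym (x ∷ []) = sym (trans (cong (isRow {r} {c}) (lookup-domain-embed x)) (isRow-embed (toMinor x)))
          preserve ltSym (x ∷ y ∷ []) = begin
            does (toMinor x <? toMinor y)                     ≡⟨ <?-cast domain≡minor x y ⟩
            does (x <? y)                                     ≡⟨ <?-cast domain≡kept x y ⟨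
            does (Fin.cast domain≡kept x <? Fin.cast domain≡kept y)
              ≡⟨ increasing⇒<?-preserved (select (col zero)) (select-increasing (col zero)) _ _ ⟨
            does (select (col zero) (Fin.cast domain≡kept x) <? select (col zero) (Fin.cast domain≡kept y))
              ≡⟨ cong₂ (λ u v → does (u <? v)) (lookup-domain x) (lookup-domain y) ⟨
            does (List.lookup domain x <? List.lookup domain y) ∎
            where open ≡-Reasoning
          preserve (entSym a a≢0) (x ∷ y ∷ []) = begin
            entry (minorOf M) a (toMinor x) (toMinor y)
              ≡⟨ entry-embed a (toMinor x) (toMinor y) ⟩
            isRow {r} {c} (embed (toMinor x)) ∧ not (isRow {r} {c} (embed (toMinor y))) ∧
              does (blockEntry col M (embed (toMinor x)) (embed (toMinor y)) ≟F a)
              ≡⟨ cong₂ (λ u v → isRow {r} {c} u ∧ not (isRow {r} {c} v) ∧ does (blockEntry col M u v ≟F a))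
                       (lookup-domain-embed x) (lookup-domain-embed y) ⟨
            isRow {r} {c} (List.lookup domain x) ∧ not (isRow {r} {c} (List.lookup domain y)) ∧
              does (blockEntry col M (List.lookup domain x) (List.lookup domain y) ≟F a)
              ≡⟨ entryᶠ-sem M col (λ i → List.lookup domain (Vec.lookup (x ∷ y ∷ []) i)) a zero (suc zero) ⟨
            rel (apply pmInterpretation (A⁺ M col)) (entSym a a≢0) (x ∷ y ∷ []) ∎
            where open ≡-Reasoning

    colouringOf : ∀ {r′ c′} → Word r r′ → Word c c′ → Colouring (r ℕ.+ c)
    colouringOf wR wC colour = Sum.[ labelOf colour wR , labelOf colour wC ]′ ∘ splitAt r
      where
      labelOf : ∀ {n n′} → Fin 2 → Word n n′ → Fin n → Bool
      labelOf zero    = keptOf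
      labelOf (suc _) = addedOf

    minorOf-colouringOf : ∀ {r′ c′} (wR : Word r r′) (wC : Word c c′) (M : Matrix r c) →
      let col = colouringOf wR wC in
      Σ (count (rowKept col) ≡ r′) λ eR → Σ (count (colKept col) ≡ c′) λ eC →
        ∀ i j → minorOf col M i j ≡ reduceMatrix wR wC M (Fin.cast eR i) (Fin.cast eC j)
    minorOf-colouringOf wR wC M =
      eR , eC , λ i j → trans (reduceC≡ _ j) (reduce-cong wC (λ l → reduceR≡ (λ z → M z l) i) (Fin.cast eC j))
      where
      onRows : ∀ colour i → colouringOf wR wC colour (i ↑ˡ c) ≡ _
      onRows colour i rewrite FinP.splitAt-↑ˡ r i c = refl
      onCols : ∀ colour j → colouringOf wR wC colour (r ↑ʳ j) ≡ _
      onCols colour j rewrite FinP.splitAt-↑ʳ r c j = refl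
      rows = wordOf-colours wR (onRows zero) (onRows (suc zero))
      cols = wordOf-colours wC (onCols zero) (onCols (suc zero))
      eR = proj₁ rows
      eC = proj₁ cols
      reduceR≡ = proj₂ rows
      reduceC≡ = proj₂ cols

  image⇒closure : ∀ 𝓜 B → InImage pmTransduction 𝓜 B → InPMClosure 𝓜 B
  image⇒closure 𝓜 B (r , c , M , M∈𝓜 , col , B≅)
    with reduceMatrix-parityMinor (wordOf (rowKept col) (rowAdded col)) (wordOf (colKept col) (colAdded col)) M
  ... | N , N⊑M , N≡ = r , c , M , _ , _ , N , M∈𝓜 , N⊑M ,
    ≅-trans B≅ (≅-trans (interpretation≅minor col M) (encode-≗ (minorOf col M) N (λ i j → sym (N≡ i j))))

  closure⇒image : ∀ 𝓜 B → InPMClosure 𝓜 B → InImage pmTransduction 𝓜 B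
  closure⇒image 𝓜 B (r , c , M , r′ , c′ , N , M∈𝓜 , N⊑M , B≅N) with parityMinor⇒words N⊑M
  ... | wR , wC , N≡ with minorOf-colouringOf wR wC M
  ...   | eR , eC , minor≡ = r , c , M , M∈𝓜 , col ,
    ≅-trans B≅N (≅-trans (≅-sym (encode-cast (minorOf col M) N eR eC minor≡N)) (≅-sym (interpretation≅minor col M)))
    where
    col = colouringOf wR wC
    minor≡N : ∀ i j → minorOf col M i j ≡ N (Fin.cast eR i) (Fin.cast eC j)
    minor≡N i j = trans (minor≡ i j) (sym (N≡ _ _))

lemma28 : (F : FiniteField) → let open Matrices F in
    Σ (Transduction MSig MSig) λ T →
      (𝓜 : MatrixClass) (B : Structure MSig) →
        InImage T 𝓜 B ⇔ InPMClosure 𝓜 B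
lemma28 F = pmTransduction F , λ 𝓜 B → mk⇔ (image⇒closure F 𝓜 B) (closure⇒image F 𝓜 B)
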